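{- Let $L$ be an ultraparacompact locale with non-degenerate Boolean algebra $B$ of complemented opens and $\mathcal J$ its set of partitions, and let $F$ be a $B_{\mathcal J}$-set. For each $x\in|F|$, the function $\hat x:=\lambda y.\bigvee\{b\in B\mid x\equiv_by\}\colon|F|\to\mathcal O(L)$ is an element of $\mathcal O(E(F))$, and the assignment $x\mapsto\hat x$ is injective. Moreover these elements generate $\mathcal O(E(F))$: every $w\in\mathcal O(E(F))$ can be expressed as $w=\bigvee_{x\in|F|}\hat x\wedge\mathrm{const}_{w(x)}$, where $\mathrm{const}_u$ is the constant function at $u$.
   Context: A locale $L$ is ultraparacompact if every open is a join of complemented opens and every open cover is refined by a partition; a partition is a set of pairwise disjoint nonzero (necessarily complemented) opens with join $\top$. $B$ is the Boolean algebra of complemented opens of $L$ (assumed $\bot\ne\top$) and $\mathcal J$ the set of all partitions of $L$. A $B_{\mathcal J}$-set $F$ is a set $|F|$ with equivalence relations $\equiv_b$ ($b\in B$) such that: (i) $x\equiv_by$ and $c\le b$ imply $x\equiv_cy$; (ii) $x\equiv_\top y$ iff $x=y$, and $x\equiv_\bot y$ always; (iii) for every $P\in\mathcal J$ and family $(x_b)_{b\in P}$ in $|F|$ there is a unique $z\in|F|$ with $z\equiv_bx_b$ for all $b\in P$. A homomorphism of $B_{\mathcal J}$-sets is a function preserving every $\equiv_b$. $\mathcal O(L)$ is a $B_{\mathcal J}$-set with $u\equiv_bv$ iff $b\wedge u=b\wedge v$. The étale space $E(F)$ is the locale whose frame $\mathcal O(E(F))$ is the set of $B_{\mathcal J}$-set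 homomorphisms $|F|\to\mathcal O(L)$, ordered pointwise. -}

module Defs where

open import Level using (Level) renaming (suc to lsuc; zero to lzero)
open import Data.Bool using (Bool; true; false)
open import Data.Product using (Σ; Σ-syntax; _×_; _,_; proj₁; proj₂; ∃)
open import Relation.Binary.PropositionalEquality using (_≡_; _≢_)
open import Relation.Binary using (IsEquivalence; IsPartialOrder)

-- Frames (= locales, via their frame of opens).  Joins are taken over
-- arbitrary families indexed by a type I : Set.

record Frame : Set₁ where
  infix  4 _≤_
  infixr 7 _∧_
  field
    Carrier  : Set
    _≤_      : Carrier → Carrier → Set
    isPO     : IsPartialOrder _≡_ _≤_
    ⊤ᴸ       : Carrier
    ⊥ᴸ       : Carrier
    ⊤-max    : ∀ u → u ≤ ⊤ᴸ
    ⊥-min    : ∀ u → ⊥ᴸ ≤ u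
    _∧_      : Carrier → Carrier → Carrier
    ∧-lb₁    : ∀ u v → u ∧ v ≤ u
    ∧-lb₂    : ∀ u v → u ∧ v ≤ v
    ∧-glb    : ∀ {u v w} → w ≤ u → w ≤ v → w ≤ u ∧ v
    ⋁        : {I : Set} → (I → Carrier) → Carrier
    ⋁-ub     : {I : Set} (f : I → Carrier) (i : I) → f i ≤ ⋁ f
    ⋁-lub    : {I : Set} (f : I → Carrier) {u : Carrier} →
               (∀ i → f i ≤ u) → ⋁ f ≤ u
    ∧-distrib-⋁ : {I : Set} (u : Carrier) (f : I → Carrier) →
                  u ∧ ⋁ f ≡ ⋁ (λ i → u ∧ f i)

  _∨_ : Carrier → Carrier → Carrier
  u ∨ v = ⋁ {Bool} (λ { true → u ; false → v })

  Complemented : Carrier → Set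
  Complemented u = Σ[ c ∈ Carrier ] ((u ∧ c ≡ ⊥ᴸ) × (u ∨ c ≡ ⊤ᴸ))

  CO : Set
  CO = Σ Carrier Complemented

  -- A partition: a subset (proposition-valued predicate) of pairwise
  -- disjoint nonzero opens with join ⊤; its members are complemented
  -- (recorded as a field, since constructively it is not derivable).
  record Partition : Set₁ where
    field
      mem        : Carrier → Set
      mem-prop   : ∀ u (p q : mem u) → p ≡ q
      nonzero    : ∀ u → mem u → u ≢ ⊥ᴸ
      disjoint   : ∀ u v → mem u → mem v → u ≢ v → u ∧ v ≡ ⊥ᴸ
      covers     : ⋁ {Σ Carrier mem} proj₁ ≡ ⊤ᴸ
      compl      : ∀ u → mem u → Complemented u

    asCO : Σ Carrier mem → CO
    asCO (u , p) = u , compl u p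

record UltraParacompact (L : Frame) : Set₁ where
  open Frame L
  field
    zeroDim : ∀ u → Σ[ I ∈ Set ] Σ[ f ∈ (I → Carrier) ]
                ((∀ i → Complemented (f i)) × (⋁ f ≡ u))
    refine  : {I : Set} (f : I → Carrier) → ⋁ f ≡ ⊤ᴸ →
              Σ[ P ∈ Partition ] (∀ u → Partition.mem P u → Σ[ i ∈ I ] (u ≤ f i))

record BJSet (L : Frame) : Set₁ where
  open Frame L
  field
    ∣_∣     : Set
    Eq      : CO → ∣_∣ → ∣_∣ → Set
    isEq    : ∀ b → IsEquivalence (Eq b)
    restr   : ∀ (b c : CO) {x y} → Eq b x y → proj₁ c ≤ proj₁ b → Eq c x y
    top     : ∀ (b : CO) {x y} → proj₁ b ≡ ⊤ᴸ → Eq b x y → x ≡ y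
    bot     : ∀ (b : CO) x y → proj₁ b ≡ ⊥ᴸ → Eq b x y
    glue    : (P : Partition) (xs : Σ Carrier (Partition.mem P) → ∣_∣) →
              Σ[ z ∈ ∣_∣ ] ((∀ m → Eq (Partition.asCO P m) z (xs m)) ×
                 (∀ z′ → (∀ m → Eq (Partition.asCO P m) z′ (xs m)) → z′ ≡ z))

open Frame public
open BJSet public

-- Homomorphisms |F| → O(L), where u ≡_b v in O(L) iff b ∧ u = b ∧ v.
-- These are the elements of the frame O(E(F)).
IsOEF : {L : Frame} (F : BJSet L) → (∣ F ∣ → Carrier L) → Set
IsOEF {L} F h = ∀ (b : CO L) x y → Eq F b x y → _∧_ L (proj₁ b) (h x) ≡ _∧_ L (proj₁ b) (h y)

hat : {L : Frame} (F : BJSet L) → ∣ F ∣ → ∣ F ∣ → Carrier L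
hat {L} F x y = ⋁ L {Σ[ b ∈ CO L ] Eq F b x y} (λ p → proj₁ (proj₁ p))

{-# OPTIONS --safe #-}
-- x̂ is a homomorphism because x ≡_c y and y ≡_b y′ give x ≡_{b ∧ c} y′.
-- Since x̂ x = ⊤, the complemented opens on which x and x′ agree cover L as
-- soon as x̂ = x̂′; a partition refining this cover exhibits both x and x′ as
-- the gluing of the constant family x, so x = x′.  Finally, for every
-- homomorphism w we have x̂ y ∧ w x ≤ w y, since w x and w y agree on each b
-- with x ≡_b y, and the summand x = y of the join is already w y.
module Submission where

open import Defs using (Frame; UltraParacompact; BJSet; IsOEF; hat)
open import Data.Bool using (true; false)
open import Data.Product using (_×_; _,_; proj₁; proj₂; Σ-syntax)
open import Relation.Binary using (IsPartialOrder; IsEquivalence; Poset)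
open import Relation.Binary.PropositionalEquality using (_≡_; _≢_; sym; trans)

module FrameProperties (L : Frame) where
  open Frame L

  open IsPartialOrder isPO public
    using ()
    renaming (refl to ≤-refl; reflexive to ≤-reflexive; trans to ≤-trans; antisym to ≤-antisym)

  poset : Poset _ _ _
  poset = record { isPartialOrder = isPO }

  open import Relation.Binary.Reasoning.PartialOrder poset

  ∧-comm : ∀ u v → u ∧ v ≡ v ∧ u
  ∧-comm u v = ≤-antisym (swap u v) (swap v u)
    where
      swap : ∀ u v → u ∧ v ≤ v ∧ u
      swap u v = ∧-glb (∧-lb₂ u v) (∧-lb₁ u v)

  ∧-mono : ∀ {u u′ v v′} → u ≤ u′ → v ≤ v′ → u ∧ v ≤ u′ ∧ v′
  ∧-mono u≤u′ v≤v′ = ∧-glb (≤-trans (∧-lb₁ _ _) u≤u′) (≤-trans (∧-lb₂ _ _) v≤v′)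

  ≤⊥⇒≡⊥ : ∀ {u} → u ≤ ⊥ᴸ → u ≡ ⊥ᴸ
  ≤⊥⇒≡⊥ u≤⊥ = ≤-antisym u≤⊥ (⊥-min _)

  ⊤≤⇒≡⊤ : ∀ {u} → ⊤ᴸ ≤ u → u ≡ ⊤ᴸ
  ⊤≤⇒≡⊤ ⊤≤u = ≤-antisym (⊤-max _) ⊤≤u

  ∨-ubˡ : ∀ u v → u ≤ u ∨ v
  ∨-ubˡ u v = ⋁-ub _ true

  ∨-ubʳ : ∀ u v → v ≤ u ∨ v
  ∨-ubʳ u v = ⋁-ub _ false

  ∨-lub : ∀ {u v w} → u ≤ w → v ≤ w → u ∨ v ≤ w
  ∨-lub u≤w v≤w = ⋁-lub _ λ { true → u≤w ; false → v≤w }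

  ∧-⋁-lub : ∀ {I : Set} {u t} (f : I → Carrier) → (∀ i → u ∧ f i ≤ t) → u ∧ ⋁ f ≤ t
  ∧-⋁-lub {u = u} {t} f bound = begin
    u ∧ ⋁ f            ≡⟨ ∧-distrib-⋁ u f ⟩
    ⋁ (λ i → u ∧ f i)  ≤⟨ ⋁-lub _ bound ⟩
    t                  ∎

  ∧-∨-lub : ∀ {u v w t} → u ∧ v ≤ t → u ∧ w ≤ t → u ∧ (v ∨ w) ≤ t
  ∧-∨-lub u∧v≤t u∧w≤t = ∧-⋁-lub _ λ { true → u∧v≤t ; false → u∧w≤t }

  ⊤-complemented : Complemented ⊤ᴸ
  ⊤-complemented = ⊥ᴸ , ≤⊥⇒≡⊥ (∧-lb₂ ⊤ᴸ ⊥ᴸ) , ⊤≤⇒≡⊤ (∨-ubˡ ⊤ᴸ ⊥ᴸ)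

  ∧-complemented : ∀ {b c} → Complemented b → Complemented c → Complemented (b ∧ c)
  ∧-complemented {b} {c} (b′ , b∧b′≡⊥ , b∨b′≡⊤) (c′ , c∧c′≡⊥ , c∨c′≡⊤) =
    b′ ∨ c′ , ≤⊥⇒≡⊥ disjoint , ⊤≤⇒≡⊤ covering
    where
      disjoint : (b ∧ c) ∧ (b′ ∨ c′) ≤ ⊥ᴸ
      disjoint = ∧-∨-lub
        (≤-trans (∧-mono (∧-lb₁ b c) ≤-refl) (≤-reflexive b∧b′≡⊥))
        (≤-trans (∧-mono (∧-lb₂ b c) ≤-refl) (≤-reflexive c∧c′≡⊥))

      b≤join : b ≤ (b ∧ c) ∨ (b′ ∨ c′)
      b≤join = begin
        b             ≤⟨ ∧-glb ≤-refl (≤-trans (⊤-max b) (≤-reflexive (sym c∨c′≡⊤))) ⟩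
        b ∧ (c ∨ c′)  ≤⟨ ∧-∨-lub (∨-ubˡ _ _) (≤-trans (∧-lb₂ b c′)
                           (≤-trans (∨-ubʳ b′ c′) (∨-ubʳ _ _))) ⟩
        (b ∧ c) ∨ (b′ ∨ c′) ∎

      covering : ⊤ᴸ ≤ (b ∧ c) ∨ (b′ ∨ c′)
      covering = begin
        ⊤ᴸ                   ≡⟨ sym b∨b′≡⊤ ⟩
        b ∨ b′               ≤⟨ ∨-lub b≤join (≤-trans (∨-ubˡ b′ c′) (∨-ubʳ _ _)) ⟩
        (b ∧ c) ∨ (b′ ∨ c′)  ∎

  ⊤ᴮ : CO
  ⊤ᴮ = ⊤ᴸ , ⊤-complemented

  _∧ᴮ_ : CO → CO → CO
  b ∧ᴮ c = proj₁ b ∧ proj₁ c , ∧-complemented (proj₂ b) (proj₂ c)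

module HatProperties {L : Frame} (F : BJSet L) where
  open Frame L
  open FrameProperties L
  open BJSet F
  open import Relation.Binary.Reasoning.PartialOrder poset

  Eq-refl : ∀ b {x} → Eq b x x
  Eq-refl b = IsEquivalence.refl (isEq b)

  Eq-sym : ∀ b {x y} → Eq b x y → Eq b y x
  Eq-sym b = IsEquivalence.sym (isEq b)

  Eq-trans : ∀ b {x y z} → Eq b x y → Eq b y z → Eq b x z
  Eq-trans b = IsEquivalence.trans (isEq b)

  Eq-on-partition⇒≡ : (P : Partition) {x y : ∣_∣} →
                      (∀ m → Eq (Partition.asCO P m) x y) → x ≡ y
  Eq-on-partition⇒≡ P {x} {y} x≡y-on-P =
    trans (glued-uniquely x x≡y-on-P) (sym (glued-uniquely y (λ m → Eq-refl _)))
    where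
      glued-uniquely : ∀ z → (∀ m → Eq (Partition.asCO P m) z y) → z ≡ proj₁ (glue P (λ _ → y))
      glued-uniquely = proj₂ (proj₂ (glue P (λ _ → y)))

  hat-refl : ∀ x → hat F x x ≡ ⊤ᴸ
  hat-refl x = ⊤≤⇒≡⊤ (⋁-ub _ (⊤ᴮ , Eq-refl ⊤ᴮ))

  ∧-hat-≤ : ∀ b x {y y′} → Eq b y y′ → proj₁ b ∧ hat F x y ≤ proj₁ b ∧ hat F x y′
  ∧-hat-≤ b x {y} {y′} y≡y′ = ∧-⋁-lub _ λ (c , x≡y) →
    ∧-glb (∧-lb₁ _ _)
      (⋁-ub _ (b ∧ᴮ c , Eq-trans (b ∧ᴮ c) (restr c (b ∧ᴮ c) x≡y (∧-lb₂ _ _))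
                                          (restr b (b ∧ᴮ c) y≡y′ (∧-lb₁ _ _))))

  hat-isOEF : ∀ x → IsOEF F (hat F x)
  hat-isOEF x b y y′ y≡y′ = ≤-antisym (∧-hat-≤ b x y≡y′) (∧-hat-≤ b x (Eq-sym b y≡y′))

  hat-∧-≤ : ∀ {w} → IsOEF F w → ∀ x y → hat F x y ∧ w x ≤ w y
  hat-∧-≤ {w} w-hom x y = begin
    hat F x y ∧ w x  ≡⟨ ∧-comm _ _ ⟩
    w x ∧ hat F x y  ≤⟨ ∧-⋁-lub _ agree ⟩
    w y              ∎
    where
      agree : (p : Σ[ b ∈ CO ] Eq b x y) → w x ∧ proj₁ (proj₁ p) ≤ w y
      agree (b , x≡y) = begin
        w x ∧ proj₁ b  ≡⟨ ∧-comm _ _ ⟩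
        proj₁ b ∧ w x  ≡⟨ w-hom b x y x≡y ⟩
        proj₁ b ∧ w y  ≤⟨ ∧-lb₂ _ _ ⟩
        w y            ∎

  ⋁-hat-∧-expansion : ∀ w → IsOEF F w → ∀ y → w y ≡ ⋁ (λ x → hat F x y ∧ w x)
  ⋁-hat-∧-expansion w w-hom y = ≤-antisym
    (begin
      w y                          ≤⟨ ∧-glb (≤-trans (⊤-max _) (≤-reflexive (sym (hat-refl y)))) ≤-refl ⟩
      hat F y y ∧ w y              ≤⟨ ⋁-ub _ y ⟩
      ⋁ (λ x → hat F x y ∧ w x)    ∎)
    (⋁-lub _ λ x → hat-∧-≤ w-hom x y)

  module _ (U : UltraParacompact L) where

    hat≡⊤⇒≡ : ∀ {x y} → hat F x y ≡ ⊤ᴸ → x ≡ y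
    hat≡⊤⇒≡ cover with UltraParacompact.refine U _ cover
    ... | P , refines = Eq-on-partition⇒≡ P λ (u , u∈P) →
      let ((b , x≡y) , u≤b) = refines u u∈P in restr b _ x≡y u≤b

    hat-injective : ∀ x x′ → (∀ y → hat F x y ≡ hat F x′ y) → x ≡ x′
    hat-injective x x′ same-hat = hat≡⊤⇒≡ (trans (same-hat x′) (hat-refl x′))

open Defs using (Carrier; ⊥ᴸ; ⊤ᴸ; _∧_; ⋁; ∣_∣)

lemma2p18 : (L : Frame) → UltraParacompact L → ⊥ᴸ L ≢ ⊤ᴸ L → (F : BJSet L) →
    ((x : ∣ F ∣) → IsOEF F (hat F x))
    × ((x x′ : ∣ F ∣) → (∀ y → hat F x y ≡ hat F x′ y) → x ≡ x′)
    × ((w : ∣ F ∣ → Carrier L) → IsOEF F w →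
        ∀ y → w y ≡ ⋁ L {∣ F ∣} (λ x → _∧_ L (hat F x y) (w x)))
lemma2p18 L U _ F = hat-isOEF , hat-injective U , ⋁-hat-∧-expansion
  where open HatProperties F
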